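{- Let $J\subseteq[n]$ and let $\mathcal{I}_J=(p_{J,1},\dots,p_{J,n})\subseteq\mathbb{C}[x_1,\dots,x_n]$. For every $j\in J$ we have $\partial_j h_{n-|J|+1}(J)\in\mathcal{I}_J$.
   Context: $h_r(S)$ is the complete homogeneous symmetric polynomial of degree $r$ in $\{x_k:k\in S\}$; $\partial_s=\partial/\partial x_s$. Define $p_{J,i}$ for $1\le i\le n$: if $i<\min(J)$, $p_{J,i}=h_i(\{i,i+1,\dots,n\})$; if $i\ge\min(J)$, $p_{J,i}=\partial_s h_r(J\cup\{i+1,\dots,n\})$ where $s=\max(J\cap\{1,\dots,i\})$ and $r=n-|J\cup\{i+1,\dots,n\}|+1$. -}

module Defs where

open import Data.Nat as ℕ using (ℕ; zero; suc; _∸_; _<ᵇ_; _≤ᵇ_)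
open import Data.Integer using (+_)
open import Data.Rational as ℚ using (ℚ; 0ℚ; 1ℚ; _/_)
open import Data.Fin using (Fin; toℕ)
open import Data.Fin.Subset using (Subset; _∈_; _∪_; ∣_∣)
open import Data.Fin.Subset.Properties using (_∈?_)
open import Data.Vec as Vec using (Vec; lookup; updateAt; replicate; tabulate)
open import Data.Vec.Properties using (≡-dec)
open import Data.List as List using (List; []; _∷_; _++_; concatMap; filter; allFin; last; foldr; map; upTo)
open import Data.Product using (_×_; _,_; Σ)
open import Data.Maybe using (Maybe; just; nothing)
open import Data.Bool using (Bool; true; false; if_then_else_)
open import Relation.Nullary using (does)
open import Relation.Binary.PropositionalEquality using (_≡_)

-- Polynomials in variables x_0 … x_{n-1} (0-based; x_k here is x_{k+1}
-- of the paper) with rational coefficients, as finite lists of terms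
-- (coefficient , exponent vector).

Mono : ℕ → Set
Mono n = Vec ℕ n

Poly : ℕ → Set
Poly n = List (ℚ × Mono n)

0P : ∀ {n} → Poly n
0P = []

constP : ∀ {n} → ℚ → Poly n
constP c = (c , replicate _ 0) ∷ []

1P : ∀ {n} → Poly n
1P = constP 1ℚ

varP : ∀ {n} → Fin n → Poly n
varP k = (1ℚ , updateAt (replicate _ 0) k (λ _ → 1)) ∷ []

infixl 6 _+P_
infixl 7 _*P_

_+P_ : ∀ {n} → Poly n → Poly n → Poly n
_+P_ = _++_

_*P_ : ∀ {n} → Poly n → Poly n → Poly n
p *P q = concatMap (λ { (a , e) → map (λ { (b , f) → (a ℚ.* b , Vec.zipWith ℕ._+_ e f) }) q }) p

_^P_ : ∀ {n} → Poly n → ℕ → Poly n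
p ^P zero = 1P
p ^P suc m = p *P (p ^P m)

coeff : ∀ {n} → Poly n → Mono n → ℚ
coeff p e = foldr (λ { (c , f) acc → if does (≡-dec ℕ._≟_ f e) then c ℚ.+ acc else acc }) 0ℚ p

infix 4 _≈P_
_≈P_ : ∀ {n} → Poly n → Poly n → Set
p ≈P q = ∀ e → coeff p e ≡ coeff q e

ℕtoℚ : ℕ → ℚ
ℕtoℚ m = (+ m) / 1

∂ : ∀ {n} → Fin n → Poly n → Poly n
∂ {n} k = concatMap (λ { (c , e) → dterm c e (lookup e k) })
  where
  dterm : ℚ → Mono n → ℕ → Poly n
  dterm c e zero = []
  dterm c e (suc m) = (c ℚ.* ℕtoℚ (suc m) , updateAt e k (λ _ → m)) ∷ []

sumP : ∀ {n} → List (Poly n) → Poly n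
sumP = foldr _+P_ 0P

elements : ∀ {n} → Subset n → List (Fin n)
elements S = filter (_∈? S) (allFin _)

hList : ∀ {n} → ℕ → List (Fin n) → Poly n
hList zero [] = 1P
hList (suc r) [] = 0P
hList r (k ∷ ks) = sumP (map (λ a → (varP k ^P a) *P hList (r ∸ a) ks) (upTo (suc r)))

h : ∀ {n} → ℕ → Subset n → Poly n
h r S = hList r (elements S)

-- the generators p_{J,i}  (i : Fin n stands for the paper's i = toℕ i + 1)

-- {i+1, …, n}  (paper's indexing), i.e. 0-based indices k with toℕ k > toℕ i
above : ∀ {n} → Fin n → Subset n
above i = tabulate (λ k → toℕ i <ᵇ toℕ k)

atLeast : ∀ {n} → Fin n → Subset n
atLeast i = tabulate (λ k → toℕ i ≤ᵇ toℕ k)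

maxUpTo : ∀ {n} → Subset n → Fin n → Maybe (Fin n)
maxUpTo J i = last (filter (λ k → k ∈? J) (List.filterᵇ (λ k → toℕ k ≤ᵇ toℕ i) (allFin _)))

-- i < min(J) iff J ∩ {1,…,i} = ∅
p : ∀ {n} → Subset n → Fin n → Poly n
p {n} J i with maxUpTo J i
... | nothing = h (suc (toℕ i)) (atLeast i)
... | just s  = ∂ s (h (n ∸ ∣ J ∪ above i ∣ ℕ.+ 1) (J ∪ above i))

InIdeal : ∀ {n m} → (Fin m → Poly n) → Poly n → Set
InIdeal {n} {m} g f = Σ (Fin m → Poly n) λ q → f ≈P sumP (List.map (λ i → q i *P g i) (allFin m))

-- Put U_c = J ∪ {c, …, n-1} (0-based indices) and d_c = n - |U_c| + 1.  By induction on c,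
-- ∂_k h_{d_c}(U_c) ∈ I_J for every k ∈ J with k < c; since U_n = J, the case c = n is the theorem.
-- From c = i to c = i + 1: if i ∈ J then U_{i+1} = U_i, and the new case k = i is the generator
-- p_{J,i} itself.  If i ∉ J then U_{i+1} = U_i - i and d_{i+1} = d_i + 1.  Splitting off a variable,
-- h_{r+1}(U) = h_{r+1}(U - i) + x_i h_r(U), and for k ∈ U the same with k gives
-- ∂_k h_{r+1}(U) = h_r(U) + x_k ∂_k h_r(U).  Combining these, for k, s ∈ U other than i,
--   ∂_k h_{r+1}(U - i) = ∂_s h_{r+1}(U - i) + (x_k - x_i) ∂_k h_r(U) + (x_i - x_s) ∂_s h_r(U).
-- With s = max(J ∩ [0, i]) the first summand is p_{J,i}, and the other two lie in I_J by induction
-- (only s ∈ J and s < i are used, not the maximality of s).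

module Submission where

open import Defs
open import Data.Nat using (ℕ; _∸_; _+_)
open import Data.Fin using (Fin)
open import Data.Fin.Subset using (Subset; _∈_; _∉_; ∣_∣; _∪_; _─_; _-_; ⁅_⁆)
open import Data.Fin.Subset.Properties
  using (_∈?_; p─q⊆p; p─⊥≡p; x∈p∧x≢y⇒x∈p-y; x∈⁅x⁆; x∈p∪q⁺; x∈p∪q⁻; ⊆-antisym; ∣p∣≤n)

open import Algebra.Bundles using (CommutativeMonoid; CommutativeRing)
import Algebra.Solver.Ring.AlmostCommutativeRing as ACR
open import Data.Bool using (Bool; true; false; if_then_else_)
import Data.Bool.Properties as BoolP
open import Data.Empty using (⊥-elim)
open import Data.Fin as F using (toℕ)
import Data.Fin.Properties as FP
open import Data.Integer as ℤ using (+_)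
import Data.Integer.Properties as ℤP
open import Data.List as L using (List; []; _∷_; _++_; map; concatMap)
import Data.List.Properties as LP
open import Data.List.Membership.Propositional using () renaming (_∈_ to _∈ₗ_)
import Data.List.Membership.Propositional.Properties as MembershipP
open import Data.List.Relation.Unary.All as All using (All; []; _∷_)
import Data.List.Relation.Unary.All.Properties as AllP
open import Data.List.Relation.Unary.AllPairs using ([]; _∷_)
open import Data.List.Relation.Unary.Any using (here; there)
open import Data.List.Relation.Unary.Unique.Propositional using (Unique)
import Data.List.Relation.Unary.Unique.Propositional.Properties as UniqueP
open import Data.Maybe using (Maybe; just; nothing)
open import Data.Nat as ℕ using (zero; suc)
import Data.Nat.Properties as ℕP
open import Data.Product using (_×_; _,_; proj₁; proj₂; ∃)
open import Data.Rational as ℚ using (ℚ; 0ℚ; 1ℚ)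
import Data.Rational.Properties as ℚP
open import Algebra.Properties.CommutativeSemigroup
  (CommutativeMonoid.commutativeSemigroup ℚP.+-0-commutativeMonoid)
  using () renaming (interchange to ℚ+-interchange)
import Data.Rational.Unnormalised as ℚᵘ
import Data.Rational.Unnormalised.Properties as ℚᵘP
open import Data.Sum as Sum using (_⊎_; inj₁; inj₂)
open import Data.Vec as V using (lookup; updateAt; replicate; here; there)
import Data.Vec.Properties as VP
open import Function using (_∘_; case_of_)
open import Function.Bundles using (Equivalence)
open import Level using (0ℓ)
open import Relation.Binary.PropositionalEquality
open import Relation.Nullary using (Dec; does; yes; no; ¬_; ¬?; _×-dec_; T?)
open import Relation.Unary using (Decidable)

-- Rational arithmetic and finite sums

ℕtoℚ-homo-+ : ∀ a b → ℕtoℚ (a ℕ.+ b) ≡ ℕtoℚ a ℚ.+ ℕtoℚ b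
ℕtoℚ-homo-+ a b = ℚP.toℚᵘ-injective (begin
  ℚ.toℚᵘ (ℕtoℚ (a ℕ.+ b))                 ≈⟨ ℚP.toℚᵘ-fromℚᵘ (ℚᵘ.mkℚᵘ (+ (a ℕ.+ b)) 0) ⟩
  ℚᵘ.mkℚᵘ (+ (a ℕ.+ b)) 0                 ≈⟨ ℚᵘ.*≡* (cong (ℤ._* + 1) numerators) ⟩
  ℚᵘ.mkℚᵘ (+ a) 0 ℚᵘ.+ ℚᵘ.mkℚᵘ (+ b) 0    ≈⟨ ℚᵘP.+-cong (from a) (from b) ⟨
  ℚ.toℚᵘ (ℕtoℚ a) ℚᵘ.+ ℚ.toℚᵘ (ℕtoℚ b)    ≈⟨ ℚP.toℚᵘ-homo-+ (ℕtoℚ a) (ℕtoℚ b) ⟨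
  ℚ.toℚᵘ (ℕtoℚ a ℚ.+ ℕtoℚ b)              ∎)
  where
  open ℚᵘP.≃-Reasoning
  from : ∀ m → ℚ.toℚᵘ (ℕtoℚ m) ℚᵘ.≃ ℚᵘ.mkℚᵘ (+ m) 0
  from m = ℚP.toℚᵘ-fromℚᵘ (ℚᵘ.mkℚᵘ (+ m) 0)
  numerators : + (a ℕ.+ b) ≡ + a ℤ.* + 1 ℤ.+ + b ℤ.* + 1
  numerators = sym (cong₂ ℤ._+_ (ℤP.*-identityʳ (+ a)) (ℤP.*-identityʳ (+ b)))

sumOf : ∀ {A : Set} → List A → (A → ℚ) → ℚ
sumOf []       F = 0ℚ
sumOf (x ∷ xs) F = F x ℚ.+ sumOf xs F

module _ {A : Set} where

  sumOf-++ : ∀ (xs ys : List A) F → sumOf (xs ++ ys) F ≡ sumOf xs F ℚ.+ sumOf ys F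
  sumOf-++ []       ys F = sym (ℚP.+-identityˡ _)
  sumOf-++ (x ∷ xs) ys F = trans (cong (F x ℚ.+_) (sumOf-++ xs ys F)) (sym (ℚP.+-assoc (F x) _ _))

  sumOf-cong : ∀ (xs : List A) {F G} → (∀ x → F x ≡ G x) → sumOf xs F ≡ sumOf xs G
  sumOf-cong []       eq = refl
  sumOf-cong (x ∷ xs) eq = cong₂ ℚ._+_ (eq x) (sumOf-cong xs eq)

  sumOf-+ : ∀ (xs : List A) F G → sumOf xs (λ x → F x ℚ.+ G x) ≡ sumOf xs F ℚ.+ sumOf xs G
  sumOf-+ []       F G = refl
  sumOf-+ (x ∷ xs) F G =
    trans (cong (F x ℚ.+ G x ℚ.+_) (sumOf-+ xs F G)) (ℚ+-interchange (F x) (G x) _ _)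

  sumOf-zero : ∀ (xs : List A) → sumOf xs (λ _ → 0ℚ) ≡ 0ℚ
  sumOf-zero []       = refl
  sumOf-zero (x ∷ xs) = trans (ℚP.+-identityˡ _) (sumOf-zero xs)

  sumOf-neg : ∀ (xs : List A) F → ℚ.- sumOf xs F ≡ sumOf xs (λ x → ℚ.- F x)
  sumOf-neg []       F = refl
  sumOf-neg (x ∷ xs) F = trans (ℚP.neg-distrib-+ (F x) _) (cong (ℚ.- F x ℚ.+_) (sumOf-neg xs F))

sumOf-map : ∀ {A B : Set} (f : A → B) (xs : List A) F → sumOf (map f xs) F ≡ sumOf xs (λ x → F (f x))
sumOf-map f []       F = refl
sumOf-map f (x ∷ xs) F = cong (F (f x) ℚ.+_) (sumOf-map f xs F)

sumOf-concatMap : ∀ {A B : Set} (G : A → List B) (xs : List A) F →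
  sumOf (concatMap G xs) F ≡ sumOf xs (λ x → sumOf (G x) F)
sumOf-concatMap G []       F = refl
sumOf-concatMap G (x ∷ xs) F =
  trans (sumOf-++ (G x) (concatMap G xs) F) (cong (sumOf (G x) F ℚ.+_) (sumOf-concatMap G xs F))

sumOf-swap : ∀ {A B : Set} (xs : List A) (ys : List B) (F : A → B → ℚ) →
  sumOf xs (λ x → sumOf ys (F x)) ≡ sumOf ys (λ y → sumOf xs (λ x → F x y))
sumOf-swap []       ys F = sym (sumOf-zero ys)
sumOf-swap (x ∷ xs) ys F = trans (cong (sumOf ys (F x) ℚ.+_) (sumOf-swap xs ys F)) (sym (sumOf-+ ys (F x) _))

-- Monomials and coefficients

infixl 6 _+ₘ_
_+ₘ_ : ∀ {n} → Mono n → Mono n → Mono n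
_+ₘ_ = V.zipWith ℕ._+_

_-ₘ_ : ∀ {n} → Mono n → Mono n → Mono n
_-ₘ_ = V.zipWith _∸_

+ₘ-comm : ∀ {n} (e f : Mono n) → e +ₘ f ≡ f +ₘ e
+ₘ-comm = VP.zipWith-comm ℕP.+-comm

+ₘ-assoc : ∀ {n} (e f g : Mono n) → e +ₘ f +ₘ g ≡ e +ₘ (f +ₘ g)
+ₘ-assoc = VP.zipWith-assoc ℕP.+-assoc

+ₘ-identityˡ : ∀ {n} (e : Mono n) → replicate n 0 +ₘ e ≡ e
+ₘ-identityˡ = VP.zipWith-identityˡ ℕP.+-identityˡ

+ₘ-∸ : ∀ {n} (e f : Mono n) → (e +ₘ f) -ₘ e ≡ f
+ₘ-∸ V.[]       V.[]       = refl
+ₘ-∸ (x V.∷ e) (y V.∷ f) = cong₂ V._∷_ (ℕP.m+n∸m≡n x y) (+ₘ-∸ e f)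

infix 4 _≟ₘ_
_≟ₘ_ : ∀ {n} (e f : Mono n) → Dec (e ≡ f)
_≟ₘ_ = VP.≡-dec ℕ._≟_

≟ₘ-≡ : ∀ {n} {e f : Mono n} → e ≡ f → does (e ≟ₘ f) ≡ true
≟ₘ-≡ {e = e} {f} eq with e ≟ₘ f
... | yes _ = refl
... | no ne = ⊥-elim (ne eq)

≟ₘ-≢ : ∀ {n} {e f : Mono n} → ¬ (e ≡ f) → does (e ≟ₘ f) ≡ false
≟ₘ-≢ {e = e} {f} ne with e ≟ₘ f
... | yes eq = ⊥-elim (ne eq)
... | no _ = refl

Term : ℕ → Set
Term n = ℚ × Mono n

coeffAt : ∀ {n} → Mono n → Term n → ℚ
coeffAt e (c , f) = if does (f ≟ₘ e) then c else 0ℚ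

coeff≡sumOf : ∀ {n} (p : Poly n) e → coeff p e ≡ sumOf p (coeffAt e)
coeff≡sumOf []            e = refl
coeff≡sumOf ((c , f) ∷ p) e with does (f ≟ₘ e)
... | true  = cong (c ℚ.+_) (coeff≡sumOf p e)
... | false = trans (coeff≡sumOf p e) (sym (ℚP.+-identityˡ _))

coeff-+P : ∀ {n} (p q : Poly n) e → coeff (p +P q) e ≡ coeff p e ℚ.+ coeff q e
coeff-+P p q e = begin
  coeff (p ++ q) e                           ≡⟨ coeff≡sumOf (p ++ q) e ⟩
  sumOf (p ++ q) (coeffAt e)                 ≡⟨ sumOf-++ p q (coeffAt e) ⟩
  sumOf p (coeffAt e) ℚ.+ sumOf q (coeffAt e) ≡⟨ cong₂ ℚ._+_ (coeff≡sumOf p e) (coeff≡sumOf q e) ⟨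
  coeff p e ℚ.+ coeff q e                    ∎
  where open ≡-Reasoning

infixl 7 _·_
_·_ : ∀ {n} → Term n → Term n → Term n
(a , e) · (b , f) = (a ℚ.* b , e +ₘ f)

sumOf-*P : ∀ {n} (p q : Poly n) F → sumOf (p *P q) F ≡ sumOf p (λ t → sumOf q (λ s → F (t · s)))
sumOf-*P p q F = trans (sumOf-concatMap _ p F) (sumOf-cong p (λ t → sumOf-map (t ·_) q F))

coeff-*P : ∀ {n} (p q : Poly n) e → coeff (p *P q) e ≡ sumOf p (λ t → sumOf q (λ s → coeffAt e (t · s)))
coeff-*P p q e = trans (coeff≡sumOf (p *P q) e) (sumOf-*P p q (coeffAt e))

sumOf-supported : ∀ {n} (q : Poly n) (w : Mono n → ℚ) (f₀ : Mono n) → (∀ f → ¬ (f ≡ f₀) → w f ≡ 0ℚ) →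
  sumOf q (λ s → proj₁ s ℚ.* w (proj₂ s)) ≡ coeff q f₀ ℚ.* w f₀
sumOf-supported []            w f₀ w≡0 = sym (ℚP.*-zeroˡ (w f₀))
sumOf-supported ((c , f) ∷ q) w f₀ w≡0 with f ≟ₘ f₀
... | yes refl = trans (cong (c ℚ.* w f ℚ.+_) (sumOf-supported q w f₀ w≡0)) (sym (ℚP.*-distribʳ-+ (w f) c _))
... | no f≢f₀  = trans (cong₂ ℚ._+_ (trans (cong (c ℚ.*_) (w≡0 f f≢f₀)) (ℚP.*-zeroʳ c)) (sumOf-supported q w f₀ w≡0))
                       (ℚP.+-identityˡ _)

coeffAt-·ˡ : ∀ {n} (t : Term n) (q : Poly n) e →
  sumOf q (λ s → coeffAt e (t · s)) ≡ coeff q (e -ₘ proj₂ t) ℚ.* coeffAt e (t · (1ℚ , e -ₘ proj₂ t))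
coeffAt-·ˡ (a , e₀) q e = trans (sumOf-cong q (λ s → coeffAt-· s)) (sumOf-supported q weight (e -ₘ e₀) off-support)
  where
  weight : Mono _ → ℚ
  weight f = coeffAt e ((a , e₀) · (1ℚ , f))
  coeffAt-· : ∀ s → coeffAt e ((a , e₀) · s) ≡ proj₁ s ℚ.* weight (proj₂ s)
  coeffAt-· (b , f) with e₀ +ₘ f ≟ₘ e
  ... | yes _ = trans (ℚP.*-comm a b) (cong (b ℚ.*_) (sym (ℚP.*-identityʳ a)))
  ... | no _  = sym (ℚP.*-zeroʳ b)
  off-support : ∀ f → ¬ (f ≡ e -ₘ e₀) → weight f ≡ 0ℚ
  off-support f f≢ with e₀ +ₘ f ≟ₘ e
  ... | yes eq = ⊥-elim (f≢ (trans (sym (+ₘ-∸ e₀ f)) (cong (_-ₘ e₀) eq)))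
  ... | no _   = refl

-- The commutative ring of polynomials

-P_ : ∀ {n} → Poly n → Poly n
-P p = map (λ { (c , e) → (ℚ.- c , e) }) p

coeff--P : ∀ {n} (p : Poly n) e → coeff (-P p) e ≡ ℚ.- coeff p e
coeff--P p e = begin
  coeff (-P p) e                         ≡⟨ coeff≡sumOf (-P p) e ⟩
  sumOf (-P p) (coeffAt e)               ≡⟨ sumOf-map _ p (coeffAt e) ⟩
  sumOf p (λ t → coeffAt e (negate t))   ≡⟨ sumOf-cong p coeffAt-negate ⟩
  sumOf p (λ t → ℚ.- coeffAt e t)        ≡⟨ sumOf-neg p (coeffAt e) ⟨
  ℚ.- sumOf p (coeffAt e)                ≡⟨ cong ℚ.-_ (coeff≡sumOf p e) ⟨
  ℚ.- coeff p e                          ∎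
  where
  open ≡-Reasoning
  negate : Term _ → Term _
  negate (c , f) = (ℚ.- c , f)
  coeffAt-negate : ∀ t → coeffAt e (negate t) ≡ ℚ.- coeffAt e t
  coeffAt-negate (c , f) with does (f ≟ₘ e)
  ... | true  = refl
  ... | false = refl

-- Unlike ≈P, which unfolds to a Π-type, this record keeps both polynomials recoverable by unification.
infix 4 _≋_
record _≋_ {n : ℕ} (p q : Poly n) : Set where
  constructor ⟨_⟩
  field coeff-≡ : p ≈P q
open _≋_ public

module PolyRingLaws {n : ℕ} where

  ≋-refl : {p : Poly n} → p ≋ p
  ≋-refl = ⟨ (λ e → refl) ⟩

  ≋-sym : {p q : Poly n} → p ≋ q → q ≋ p
  ≋-sym ⟨ eq ⟩ = ⟨ (λ e → sym (eq e)) ⟩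

  ≋-trans : {p q r : Poly n} → p ≋ q → q ≋ r → p ≋ r
  ≋-trans ⟨ eq₁ ⟩ ⟨ eq₂ ⟩ = ⟨ (λ e → trans (eq₁ e) (eq₂ e)) ⟩

  ≋-reflexive : {p q : Poly n} → p ≡ q → p ≋ q
  ≋-reflexive refl = ≋-refl

  +P-cong : {p p′ q q′ : Poly n} → p ≋ p′ → q ≋ q′ → p +P q ≋ p′ +P q′
  +P-cong {p} {p′} {q} {q′} ⟨ eq₁ ⟩ ⟨ eq₂ ⟩ =
    ⟨ (λ e → trans (coeff-+P p q e) (trans (cong₂ ℚ._+_ (eq₁ e) (eq₂ e)) (sym (coeff-+P p′ q′ e)))) ⟩

  +P-assoc : (p q r : Poly n) → p +P q +P r ≋ p +P (q +P r)
  +P-assoc p q r = ≋-reflexive (LP.++-assoc p q r)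

  +P-comm : (p q : Poly n) → p +P q ≋ q +P p
  +P-comm p q =
    ⟨ (λ e → trans (coeff-+P p q e) (trans (ℚP.+-comm (coeff p e) (coeff q e)) (sym (coeff-+P q p e)))) ⟩

  +P-identityʳ : (p : Poly n) → p +P 0P ≋ p
  +P-identityʳ p = ≋-reflexive (LP.++-identityʳ p)

  -P-cong : {p q : Poly n} → p ≋ q → -P p ≋ -P q
  -P-cong {p} {q} ⟨ eq ⟩ = ⟨ (λ e → trans (coeff--P p e) (trans (cong ℚ.-_ (eq e)) (sym (coeff--P q e)))) ⟩

  -P-inverseˡ : (p : Poly n) → -P p +P p ≋ 0P
  -P-inverseˡ p = ⟨ (λ e → trans (coeff-+P (-P p) p e)
    (trans (cong (ℚ._+ coeff p e) (coeff--P p e)) (ℚP.+-inverseˡ (coeff p e)))) ⟩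

  *P-comm : (p q : Poly n) → p *P q ≋ q *P p
  *P-comm p q = ⟨ (λ e → begin
    coeff (p *P q) e                                    ≡⟨ coeff-*P p q e ⟩
    sumOf p (λ t → sumOf q (λ s → coeffAt e (t · s)))   ≡⟨ sumOf-swap p q _ ⟩
    sumOf q (λ s → sumOf p (λ t → coeffAt e (t · s)))   ≡⟨ sumOf-cong q (λ s → sumOf-cong p (λ t → cong (coeffAt e) (·-comm t s))) ⟩
    sumOf q (λ s → sumOf p (λ t → coeffAt e (s · t)))   ≡⟨ coeff-*P q p e ⟨
    coeff (q *P p) e                                    ∎) ⟩
    where
    open ≡-Reasoning
    ·-comm : (t s : Term n) → t · s ≡ s · t
    ·-comm (a , f) (b , g) = cong₂ _,_ (ℚP.*-comm a b) (+ₘ-comm f g)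

  *P-assoc : (p q r : Poly n) → p *P q *P r ≋ p *P (q *P r)
  *P-assoc p q r = ⟨ (λ e → begin
    coeff (p *P q *P r) e                                      ≡⟨ coeff-*P (p *P q) r e ⟩
    sumOf (p *P q) (λ x → sumOf r (λ u → coeffAt e (x · u)))   ≡⟨ sumOf-*P p q _ ⟩
    sumOf p (λ t → sumOf q (λ s → sumOf r (λ u → coeffAt e (t · s · u))))
      ≡⟨ sumOf-cong p (λ t → sumOf-cong q (λ s → sumOf-cong r (λ u → cong (coeffAt e) (·-assoc t s u)))) ⟩
    sumOf p (λ t → sumOf q (λ s → sumOf r (λ u → coeffAt e (t · (s · u)))))
      ≡⟨ sumOf-cong p (λ t → sumOf-*P q r _) ⟨
    sumOf p (λ t → sumOf (q *P r) (λ x → coeffAt e (t · x)))   ≡⟨ coeff-*P p (q *P r) e ⟨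
    coeff (p *P (q *P r)) e                                    ∎) ⟩
    where
    open ≡-Reasoning
    ·-assoc : (t s u : Term n) → t · s · u ≡ t · (s · u)
    ·-assoc (a , f) (b , g) (c , h) = cong₂ _,_ (ℚP.*-assoc a b c) (+ₘ-assoc f g h)

  *P-zeroʳ : (p : Poly n) → p *P 0P ≡ 0P
  *P-zeroʳ []      = refl
  *P-zeroʳ (t ∷ p) = *P-zeroʳ p

  *P-congˡ : (p : Poly n) {q q′ : Poly n} → q ≋ q′ → p *P q ≋ p *P q′
  *P-congˡ p {q} {q′} ⟨ eq ⟩ =
    ⟨ (λ e → trans (coeff-*P p q e) (trans (sumOf-cong p (same-shifts e)) (sym (coeff-*P p q′ e)))) ⟩
    where
    same-shifts : ∀ e t → sumOf q (λ s → coeffAt e (t · s)) ≡ sumOf q′ (λ s → coeffAt e (t · s))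
    same-shifts e t = trans (coeffAt-·ˡ t q e) (trans (cong (ℚ._* _) (eq _)) (sym (coeffAt-·ˡ t q′ e)))

  *P-cong : {p p′ q q′ : Poly n} → p ≋ p′ → q ≋ q′ → p *P q ≋ p′ *P q′
  *P-cong {p} {p′} {q} {q′} p≋p′ q≋q′ =
    ≋-trans (*P-congˡ p q≋q′) (≋-trans (*P-comm p q′) (≋-trans (*P-congˡ q′ p≋p′) (*P-comm q′ p′)))

  *P-identityˡ : (p : Poly n) → 1P *P p ≋ p
  *P-identityˡ p = ⟨ (λ e → trans (coeff-*P 1P p e)
    (trans (ℚP.+-identityʳ _) (trans (sumOf-cong p (λ s → cong (coeffAt e) (1·s s))) (sym (coeff≡sumOf p e))))) ⟩
    where
    1·s : (s : Term n) → (1ℚ , replicate n 0) · s ≡ s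
    1·s (b , f) = cong₂ _,_ (ℚP.*-identityˡ b) (+ₘ-identityˡ f)

  *P-distribˡ : (p q r : Poly n) → p *P (q +P r) ≋ p *P q +P p *P r
  *P-distribˡ p q r = ⟨ (λ e → begin
    coeff (p *P (q ++ r)) e                               ≡⟨ coeff-*P p (q ++ r) e ⟩
    sumOf p (λ t → sumOf (q ++ r) (λ s → coeffAt e (t · s)))
      ≡⟨ sumOf-cong p (λ t → sumOf-++ q r _) ⟩
    sumOf p (λ t → sumOf q (λ s → coeffAt e (t · s)) ℚ.+ sumOf r (λ s → coeffAt e (t · s)))
      ≡⟨ sumOf-+ p _ _ ⟩
    sumOf p (λ t → sumOf q (λ s → coeffAt e (t · s))) ℚ.+ sumOf p (λ t → sumOf r (λ s → coeffAt e (t · s)))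
      ≡⟨ cong₂ ℚ._+_ (coeff-*P p q e) (coeff-*P p r e) ⟨
    coeff (p *P q) e ℚ.+ coeff (p *P r) e                 ≡⟨ coeff-+P (p *P q) (p *P r) e ⟨
    coeff (p *P q +P p *P r) e                            ∎) ⟩
    where open ≡-Reasoning

Poly-commutativeRing : ℕ → CommutativeRing 0ℓ 0ℓ
Poly-commutativeRing n = record
  { Carrier = Poly n
  ; _≈_ = _≋_
  ; _+_ = _+P_
  ; _*_ = _*P_
  ; -_ = -P_
  ; 0# = 0P
  ; 1# = 1P
  ; isCommutativeRing = record
    { isRing = record
      { +-isAbelianGroup = record
        { isGroup = record
          { isMonoid = record
            { isSemigroup = record
              { isMagma = record
                { isEquivalence = record { refl = ≋-refl ; sym = ≋-sym ; trans = ≋-trans }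
                ; ∙-cong = +P-cong }
              ; assoc = +P-assoc }
            ; identity = (λ p → ≋-refl) , +P-identityʳ }
          ; inverse = -P-inverseˡ , (λ p → ≋-trans (+P-comm p (-P p)) (-P-inverseˡ p))
          ; ⁻¹-cong = -P-cong }
        ; comm = +P-comm }
      ; *-cong = *P-cong
      ; *-assoc = *P-assoc
      ; *-identity = *P-identityˡ , (λ p → ≋-trans (*P-comm p 1P) (*P-identityˡ p))
      ; distrib = *P-distribˡ
                , (λ p q r → ≋-trans (*P-comm (q +P r) p)
                               (≋-trans (*P-distribˡ p q r) (+P-cong (*P-comm p q) (*P-comm p r)))) }
    ; *-comm = *P-comm }
  }
  where open PolyRingLaws {n}

merge-like-terms : ∀ {n} (b d : ℚ) (f : Mono n) → (b , f) ∷ (d , f) ∷ [] ≋ (b ℚ.+ d , f) ∷ []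
merge-like-terms b d f = ⟨ (λ e → merge (does (f ≟ₘ e))) ⟩
  where
  merge : ∀ x → (if x then b ℚ.+ (if x then d ℚ.+ 0ℚ else 0ℚ) else (if x then d ℚ.+ 0ℚ else 0ℚ))
              ≡ (if x then (b ℚ.+ d) ℚ.+ 0ℚ else 0ℚ)
  merge true  = sym (ℚP.+-assoc b d 0ℚ)
  merge false = refl

module PolySolver (n : ℕ) where
  open PolyRingLaws {n}

  constP-morphism : ACR._-Raw-AlmostCommutative⟶_ (CommutativeRing.rawRing ℚP.+-*-commutativeRing)
                                                  (ACR.fromCommutativeRing (Poly-commutativeRing n))
  constP-morphism = record
    { ⟦_⟧ = constP
    ; +-homo = λ a b → ≋-sym (merge-like-terms a b (replicate n 0))
    ; *-homo = λ a b → ≋-trans (≋-reflexive (cong (λ z → (a ℚ.* b , z) ∷ []) (sym (+ₘ-identityˡ (replicate n 0)))))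
                               (≋-sym (+P-identityʳ _))
    ; -‿homo = λ a → ≋-refl
    ; 0-homo = ⟨ (λ e → zero-coeff (does (replicate n 0 ≟ₘ e))) ⟩
    ; 1-homo = ≋-refl
    }
    where
    zero-coeff : ∀ b → (if b then 0ℚ ℚ.+ 0ℚ else 0ℚ) ≡ 0ℚ
    zero-coeff true  = refl
    zero-coeff false = refl

  constP-≟ : ∀ a b → Maybe (constP a ≋ constP b)
  constP-≟ a b with a ℚP.≟ b
  ... | yes refl = just ≋-refl
  ... | no _     = nothing

  open import Algebra.Solver.Ring (CommutativeRing.rawRing ℚP.+-*-commutativeRing)
    (ACR.fromCommutativeRing (Poly-commutativeRing n)) constP-morphism constP-≟ public

-- Partial derivatives

∂term : ∀ {n} → Fin n → Term n → ℕ → Poly n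
∂term k (c , e) zero    = []
∂term k (c , e) (suc m) = (c ℚ.* ℕtoℚ (suc m) , updateAt e k (λ _ → m)) ∷ []

∂ₜ : ∀ {n} → Fin n → Term n → Poly n
∂ₜ k (c , e) = ∂term k (c , e) (lookup e k)

∂-∷ : ∀ {n} (k : Fin n) t (p : Poly n) → ∂ k (t ∷ p) ≡ ∂ₜ k t ++ ∂ k p
∂-∷ k (c , e) p with lookup e k
... | zero  = refl
... | suc m = refl

∂-+P : ∀ {n} (k : Fin n) (p q : Poly n) → ∂ k (p +P q) ≡ ∂ k p +P ∂ k q
∂-+P k []      q = refl
∂-+P k (t ∷ p) q = begin
  ∂ k (t ∷ p ++ q)             ≡⟨ ∂-∷ k t (p ++ q) ⟩
  ∂ₜ k t ++ ∂ k (p ++ q)       ≡⟨ cong (∂ₜ k t ++_) (∂-+P k p q) ⟩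
  ∂ₜ k t ++ (∂ k p ++ ∂ k q)   ≡⟨ LP.++-assoc (∂ₜ k t) (∂ k p) (∂ k q) ⟨
  (∂ₜ k t ++ ∂ k p) ++ ∂ k q   ≡⟨ cong (_++ ∂ k q) (∂-∷ k t p) ⟨
  ∂ k (t ∷ p) ++ ∂ k q         ∎
  where open ≡-Reasoning

bump : ∀ {n} → Fin n → Mono n → Mono n
bump k e = updateAt e k suc

bumpFactor : ∀ {n} → Fin n → Mono n → ℚ
bumpFactor k e = ℕtoℚ (suc (lookup e k))

coeff-∂ₜ : ∀ {n} (k : Fin n) (t : Term n) e → coeff (∂ₜ k t) e ≡ coeff (t ∷ []) (bump k e) ℚ.* bumpFactor k e
coeff-∂ₜ k (c , f) e with lookup f k in f-k
... | zero = begin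
  0ℚ                                                            ≡⟨ ℚP.*-zeroˡ (bumpFactor k e) ⟨
  0ℚ ℚ.* bumpFactor k e                                         ≡⟨ cong (λ b → (if b then c ℚ.+ 0ℚ else 0ℚ) ℚ.* _) (≟ₘ-≢ f≢) ⟨
  (if does (f ≟ₘ bump k e) then c ℚ.+ 0ℚ else 0ℚ) ℚ.* bumpFactor k e ∎
  where
  open ≡-Reasoning
  f≢ : ¬ (f ≡ bump k e)
  f≢ refl with trans (sym f-k) (VP.lookup∘updateAt k e)
  ... | ()
... | suc m with f ≟ₘ bump k e
...   | yes refl = begin
  (if does (updateAt (bump k e) k (λ _ → m) ≟ₘ e) then c ℚ.* ℕtoℚ (suc m) ℚ.+ 0ℚ else 0ℚ)
    ≡⟨ cong (λ b → if b then c ℚ.* ℕtoℚ (suc m) ℚ.+ 0ℚ else 0ℚ) (≟ₘ-≡ (trans (cong (λ x → updateAt (bump k e) k (λ _ → x)) m≡e-k)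
                                                                      (trans (VP.updateAt-updateAt k e) (VP.updateAt-id-local k e refl)))) ⟩
  c ℚ.* ℕtoℚ (suc m) ℚ.+ 0ℚ ≡⟨ ℚP.+-identityʳ _ ⟩
  c ℚ.* ℕtoℚ (suc m)        ≡⟨ cong₂ ℚ._*_ (ℚP.+-identityʳ c) (cong (ℕtoℚ ∘ suc) (sym m≡e-k)) ⟨
  (c ℚ.+ 0ℚ) ℚ.* bumpFactor k e ∎
  where
  open ≡-Reasoning
  m≡e-k : m ≡ lookup e k
  m≡e-k = ℕP.suc-injective (trans (sym f-k) (VP.lookup∘updateAt k e))
...   | no f≢ = begin
  (if does (updateAt f k (λ _ → m) ≟ₘ e) then c ℚ.* ℕtoℚ (suc m) ℚ.+ 0ℚ else 0ℚ)
    ≡⟨ cong (λ b → if b then c ℚ.* ℕtoℚ (suc m) ℚ.+ 0ℚ else 0ℚ) (≟ₘ-≢ (λ eq → f≢ (bump-lower eq))) ⟩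
  0ℚ                     ≡⟨ ℚP.*-zeroˡ (bumpFactor k e) ⟨
  0ℚ ℚ.* bumpFactor k e  ∎
  where
  open ≡-Reasoning
  bump-lower : updateAt f k (λ _ → m) ≡ e → f ≡ bump k e
  bump-lower refl = sym (trans (VP.updateAt-updateAt k f) (VP.updateAt-id-local k f (sym f-k)))

coeff-∂ : ∀ {n} (k : Fin n) (p : Poly n) e → coeff (∂ k p) e ≡ coeff p (bump k e) ℚ.* bumpFactor k e
coeff-∂ k []      e = sym (ℚP.*-zeroˡ (bumpFactor k e))
coeff-∂ k (t ∷ p) e = begin
  coeff (∂ k (t ∷ p)) e                          ≡⟨ cong (λ q → coeff q e) (∂-∷ k t p) ⟩
  coeff (∂ₜ k t ++ ∂ k p) e                      ≡⟨ coeff-+P (∂ₜ k t) (∂ k p) e ⟩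
  coeff (∂ₜ k t) e ℚ.+ coeff (∂ k p) e           ≡⟨ cong₂ ℚ._+_ (coeff-∂ₜ k t e) (coeff-∂ k p e) ⟩
  coeff (t ∷ []) e′ ℚ.* N ℚ.+ coeff p e′ ℚ.* N   ≡⟨ ℚP.*-distribʳ-+ N (coeff (t ∷ []) e′) (coeff p e′) ⟨
  (coeff (t ∷ []) e′ ℚ.+ coeff p e′) ℚ.* N       ≡⟨ cong (ℚ._* N) (coeff-+P (t ∷ []) p e′) ⟨
  coeff (t ∷ p) e′ ℚ.* N                         ∎
  where
  open ≡-Reasoning
  e′ = bump k e
  N = bumpFactor k e

∂-cong : ∀ {n} (k : Fin n) {p q : Poly n} → p ≋ q → ∂ k p ≋ ∂ k q
∂-cong k {p} {q} ⟨ eq ⟩ =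
  ⟨ (λ e → trans (coeff-∂ k p e) (trans (cong (ℚ._* bumpFactor k e) (eq (bump k e))) (sym (coeff-∂ k q e)))) ⟩

unitₘ : ∀ {n} → Fin n → Mono n
unitₘ k = updateAt (replicate _ 0) k (λ _ → 1)

varₜ : ∀ {n} → Fin n → Term n
varₜ k = (1ℚ , unitₘ k)

lookup-unitₘ-≢ : ∀ {n} {i k : Fin n} → ¬ (i ≡ k) → lookup (unitₘ i) k ≡ 0
lookup-unitₘ-≢ {n} {i} {k} i≢k = trans (VP.lookup∘updateAt′ k i (i≢k ∘ sym) (replicate n 0)) (VP.lookup-replicate k 0)

lookup-+ₘ : ∀ {n} (e f : Mono n) k → lookup (e +ₘ f) k ≡ lookup e k ℕ.+ lookup f k
lookup-+ₘ e f k = VP.lookup-zipWith ℕ._+_ k e f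

updateAt-+ₘ : ∀ {n} (e f : Mono n) k m → lookup e k ≡ 0 → updateAt (e +ₘ f) k (λ _ → m) ≡ e +ₘ updateAt f k (λ _ → m)
updateAt-+ₘ (x V.∷ e) (y V.∷ f) F.zero    m x≡0 = cong (V._∷ _) (cong (ℕ._+ m) (sym x≡0))
updateAt-+ₘ (x V.∷ e) (y V.∷ f) (F.suc k) m e≡0 = cong (_ V.∷_) (updateAt-+ₘ e f k m e≡0)

updateAt-unitₘ+ₘ : ∀ {n} (k : Fin n) (f : Mono n) → updateAt (unitₘ k +ₘ f) k (λ _ → lookup f k) ≡ f
updateAt-unitₘ+ₘ F.zero    (y V.∷ f) = cong (y V.∷_) (+ₘ-identityˡ f)
updateAt-unitₘ+ₘ (F.suc k) (y V.∷ f) = cong (y V.∷_) (updateAt-unitₘ+ₘ k f)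

unitₘ+ₘ-updateAt : ∀ {n} (k : Fin n) (f : Mono n) m → lookup f k ≡ suc m → unitₘ k +ₘ updateAt f k (λ _ → m) ≡ f
unitₘ+ₘ-updateAt F.zero    (y V.∷ f) m y≡1+m = cong₂ V._∷_ (sym y≡1+m) (+ₘ-identityˡ f)
unitₘ+ₘ-updateAt (F.suc k) (y V.∷ f) m f-k    = cong (y V.∷_) (unitₘ+ₘ-updateAt k f m f-k)

lookup-unitₘ+ₘ : ∀ {n} (k : Fin n) (f : Mono n) → lookup (unitₘ k +ₘ f) k ≡ suc (lookup f k)
lookup-unitₘ+ₘ F.zero    (y V.∷ f) = refl
lookup-unitₘ+ₘ (F.suc k) (y V.∷ f) = lookup-unitₘ+ₘ k f

∂ₜ-varₜ-≢ : ∀ {n} {i k : Fin n} → ¬ (i ≡ k) → (t : Term n) → ∂ₜ k (varₜ i · t) ≡ map (varₜ i ·_) (∂ₜ k t)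
∂ₜ-varₜ-≢ {i = i} {k} i≢k (c , f) rewrite lookup-+ₘ (unitₘ i) f k | lookup-unitₘ-≢ i≢k with lookup f k
... | zero  = refl
... | suc m = cong (_∷ []) (cong₂ _,_ (ℚP.*-assoc 1ℚ c (ℕtoℚ (suc m))) (updateAt-+ₘ (unitₘ i) f k m (lookup-unitₘ-≢ i≢k)))

∂-map-varₜ-≢ : ∀ {n} {i k : Fin n} → ¬ (i ≡ k) → (H : Poly n) → ∂ k (map (varₜ i ·_) H) ≡ map (varₜ i ·_) (∂ k H)
∂-map-varₜ-≢             i≢k []      = refl
∂-map-varₜ-≢ {i = i} {k} i≢k (t ∷ H) = begin
  ∂ k (varₜ i · t ∷ map (varₜ i ·_) H)                  ≡⟨ ∂-∷ k (varₜ i · t) (map (varₜ i ·_) H) ⟩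
  ∂ₜ k (varₜ i · t) ++ ∂ k (map (varₜ i ·_) H)          ≡⟨ cong₂ _++_ (∂ₜ-varₜ-≢ i≢k t) (∂-map-varₜ-≢ i≢k H) ⟩
  map (varₜ i ·_) (∂ₜ k t) ++ map (varₜ i ·_) (∂ k H)   ≡⟨ LP.map-++ (varₜ i ·_) (∂ₜ k t) (∂ k H) ⟨
  map (varₜ i ·_) (∂ₜ k t ++ ∂ k H)                     ≡⟨ cong (map (varₜ i ·_)) (∂-∷ k t H) ⟨
  map (varₜ i ·_) (∂ k (t ∷ H))                         ∎
  where open ≡-Reasoning

-- varP i *P H unfolds to map (varₜ i ·_) H ++ [].
∂-varP-*P-≢ : ∀ {n} {i k : Fin n} → ¬ (i ≡ k) → (H : Poly n) → ∂ k (varP i *P H) ≡ varP i *P ∂ k H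
∂-varP-*P-≢ {i = i} {k} i≢k H = trans (∂-+P k (map (varₜ i ·_) H) []) (cong (_++ []) (∂-map-varₜ-≢ i≢k H))

∂ₜ-varₜ : ∀ {n} (k : Fin n) (t : Term n) → ∂ₜ k (varₜ k · t) ≋ t ∷ map (varₜ k ·_) (∂ₜ k t)
∂ₜ-varₜ k (c , f) rewrite lookup-unitₘ+ₘ k f | updateAt-unitₘ+ₘ k f with lookup f k in f-k
... | zero  = ≋-reflexive (cong (λ a → (a , f) ∷ []) (trans (cong (ℚ._* 1ℚ) (ℚP.*-identityˡ c)) (ℚP.*-identityʳ c)))
  where open PolyRingLaws
... | suc m rewrite unitₘ+ₘ-updateAt k f m f-k =
  ≋-trans (≋-reflexive (cong (λ a → (a , f) ∷ []) exponent-step)) (≋-sym (merge-like-terms c _ f))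
  where
  open PolyRingLaws
  exponent-step : 1ℚ ℚ.* c ℚ.* ℕtoℚ (suc (suc m)) ≡ c ℚ.+ 1ℚ ℚ.* (c ℚ.* ℕtoℚ (suc m))
  exponent-step = begin
    1ℚ ℚ.* c ℚ.* ℕtoℚ (suc (suc m))       ≡⟨ cong₂ ℚ._*_ (ℚP.*-identityˡ c) (ℕtoℚ-homo-+ 1 (suc m)) ⟩
    c ℚ.* (1ℚ ℚ.+ ℕtoℚ (suc m))           ≡⟨ ℚP.*-distribˡ-+ c 1ℚ _ ⟩
    c ℚ.* 1ℚ ℚ.+ c ℚ.* ℕtoℚ (suc m)       ≡⟨ cong₂ ℚ._+_ (ℚP.*-identityʳ c) (sym (ℚP.*-identityˡ (c ℚ.* ℕtoℚ (suc m)))) ⟩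
    c ℚ.+ 1ℚ ℚ.* (c ℚ.* ℕtoℚ (suc m))     ∎
    where open ≡-Reasoning

∂-map-varₜ : ∀ {n} (k : Fin n) (H : Poly n) → ∂ k (map (varₜ k ·_) H) ≋ H +P map (varₜ k ·_) (∂ k H)
∂-map-varₜ k []          = PolyRingLaws.≋-refl
∂-map-varₜ {n} k (t ∷ H) = begin
  ∂ k (map (varₜ k ·_) (t ∷ H))                                          ≡⟨ ∂-∷ k (varₜ k · t) (map (varₜ k ·_) H) ⟩
  ∂ₜ k (varₜ k · t) ++ ∂ k (map (varₜ k ·_) H)                           ≈⟨ +P-cong (∂ₜ-varₜ k t) (∂-map-varₜ k H) ⟩
  (t ∷ []) +P map (varₜ k ·_) (∂ₜ k t) +P (H +P map (varₜ k ·_) (∂ k H))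
    ≈⟨ solve 4 (λ T A B C → (T :+ A) :+ (B :+ C) := (T :+ B) :+ (A :+ C)) ≋-refl
        (t ∷ []) (map (varₜ k ·_) (∂ₜ k t)) H (map (varₜ k ·_) (∂ k H)) ⟩
  (t ∷ H) +P (map (varₜ k ·_) (∂ₜ k t) +P map (varₜ k ·_) (∂ k H))       ≡⟨ cong ((t ∷ H) ++_) (LP.map-++ _ (∂ₜ k t) (∂ k H)) ⟨
  (t ∷ H) +P map (varₜ k ·_) (∂ₜ k t ++ ∂ k H)                           ≡⟨ cong (λ q → (t ∷ H) ++ map (varₜ k ·_) q) (∂-∷ k t H) ⟨
  (t ∷ H) +P map (varₜ k ·_) (∂ k (t ∷ H))                               ∎
  where
  open PolyRingLaws {n}
  open PolySolver n
  open import Relation.Binary.Reasoning.Setoid (CommutativeRing.setoid (Poly-commutativeRing n))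

∂-varP-*P : ∀ {n} (k : Fin n) (H : Poly n) → ∂ k (varP k *P H) ≋ H +P varP k *P ∂ k H
∂-varP-*P {n} k H = begin
  ∂ k (map (varₜ k ·_) H ++ [])               ≡⟨ ∂-+P k (map (varₜ k ·_) H) [] ⟩
  ∂ k (map (varₜ k ·_) H) ++ []               ≈⟨ +P-identityʳ _ ⟩
  ∂ k (map (varₜ k ·_) H)                     ≈⟨ ∂-map-varₜ k H ⟩
  H +P map (varₜ k ·_) (∂ k H)                ≈⟨ +P-cong ≋-refl (+P-identityʳ (map (varₜ k ·_) (∂ k H))) ⟨
  H +P varP k *P ∂ k H                        ∎
  where
  open PolyRingLaws {n}
  open import Relation.Binary.Reasoning.Setoid (CommutativeRing.setoid (Poly-commutativeRing n))

-- Complete homogeneous symmetric polynomials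

FreeOf : ∀ {n} → Fin n → Poly n → Set
FreeOf k p = All (λ t → lookup (proj₂ t) k ≡ 0) p

∂-FreeOf : ∀ {n} (k : Fin n) (p : Poly n) → FreeOf k p → ∂ k p ≡ 0P
∂-FreeOf k []            []          = refl
∂-FreeOf k ((c , f) ∷ p) (f-k ∷ fp) rewrite f-k = ∂-FreeOf k p fp

FreeOf-*P : ∀ {n} {k : Fin n} (p q : Poly n) → FreeOf k p → FreeOf k q → FreeOf k (p *P q)
FreeOf-*P             []      q []         fq = []
FreeOf-*P {k = k} (t ∷ p) q (t-k ∷ fp) fq = AllP.++⁺ (AllP.map⁺ {f = t ·_} (All.map (λ {s} → free-· s) fq)) (FreeOf-*P p q fp fq)
  where
  free-· : ∀ s → lookup (proj₂ s) k ≡ 0 → lookup (proj₂ (t · s)) k ≡ 0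
  free-· s s-k = trans (lookup-+ₘ (proj₂ t) (proj₂ s) k) (cong₂ ℕ._+_ t-k s-k)

FreeOf-^P : ∀ {n} {k : Fin n} (p : Poly n) m → FreeOf k p → FreeOf k (p ^P m)
FreeOf-^P {k = k} p zero    fp = VP.lookup-replicate k 0 ∷ []
FreeOf-^P         p (suc m) fp = FreeOf-*P p (p ^P m) fp (FreeOf-^P p m fp)

FreeOf-sumP : ∀ {n} {k : Fin n} (ps : List (Poly n)) → All (FreeOf k) ps → FreeOf k (sumP ps)
FreeOf-sumP []       []        = []
FreeOf-sumP (p ∷ ps) (fp ∷ fps) = AllP.++⁺ fp (FreeOf-sumP ps fps)

hList-∷ : ∀ {n} r (j : Fin n) L → hList r (j ∷ L) ≡ sumP (map (λ a → (varP j ^P a) *P hList (r ∸ a) L) (L.upTo (suc r)))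
hList-∷ zero    j L = refl
hList-∷ (suc r) j L = refl

FreeOf-hList : ∀ {n} (k : Fin n) r (L : List (Fin n)) → All (λ j → ¬ (j ≡ k)) L → FreeOf k (hList r L)
FreeOf-hList k zero    []      []          = VP.lookup-replicate k 0 ∷ []
FreeOf-hList k (suc r) []      []          = []
FreeOf-hList k r       (j ∷ L) (j≢k ∷ L≢k) rewrite hList-∷ r j L =
  FreeOf-sumP (map term (L.upTo (suc r))) (AllP.map⁺ (All.universal free-term (L.upTo (suc r))))
  where
  term : ℕ → Poly _
  term a = (varP j ^P a) *P hList (r ∸ a) L
  free-term : ∀ a → FreeOf k (term a)
  free-term a = FreeOf-*P (varP j ^P a) (hList (r ∸ a) L)
    (FreeOf-^P (varP j) a (lookup-unitₘ-≢ j≢k ∷ [])) (FreeOf-hList k (r ∸ a) L L≢k)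

del : ∀ {n} → Fin n → List (Fin n) → List (Fin n)
del k = L.filter (λ j → ¬? (j F.≟ k))

module _ {n : ℕ} where
  open PolyRingLaws {n}
  open PolySolver n
  open import Relation.Binary.Reasoning.Setoid (CommutativeRing.setoid (Poly-commutativeRing n))

  *P-sumP : (x : Poly n) (ps : List (Poly n)) → x *P sumP ps ≋ sumP (map (x *P_) ps)
  *P-sumP x []       = ≋-reflexive (*P-zeroʳ x)
  *P-sumP x (p ∷ ps) = ≋-trans (*P-distribˡ x p (sumP ps)) (+P-cong ≋-refl (*P-sumP x ps))

  sumP-applyUpTo-cong : (F G : ℕ → Poly n) → (∀ a → F a ≋ G a) → ∀ m → sumP (L.applyUpTo F m) ≋ sumP (L.applyUpTo G m)
  sumP-applyUpTo-cong F G F≋G zero    = ≋-refl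
  sumP-applyUpTo-cong F G F≋G (suc m) = +P-cong (F≋G 0) (sumP-applyUpTo-cong (F ∘ suc) (G ∘ suc) (F≋G ∘ suc) m)

  hList-zero : (L : List (Fin n)) → hList 0 L ≋ 1P
  hList-zero []      = ≋-refl
  hList-zero (j ∷ L) = ≋-trans (+P-identityʳ _) (≋-trans (*P-identityˡ _) (hList-zero L))

  hList-suc-∷ : ∀ r (j : Fin n) L → hList (suc r) (j ∷ L) ≋ hList (suc r) L +P varP j *P hList r (j ∷ L)
  hList-suc-∷ r j L = begin
    F 0 +P sumP (map F (L.applyUpTo suc (suc r)))     ≡⟨ cong (λ ps → F 0 +P sumP ps) (LP.map-applyUpTo suc F (suc r)) ⟩
    F 0 +P sumP (L.applyUpTo (F ∘ suc) (suc r))       ≈⟨ +P-cong (*P-identityˡ (hList (suc r) L)) (sumP-applyUpTo-cong (F ∘ suc) ((varP j *P_) ∘ G)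
                                                            (λ a → *P-assoc (varP j) (varP j ^P a) (hList (r ∸ a) L)) (suc r)) ⟩
    hList (suc r) L +P sumP (L.applyUpTo ((varP j *P_) ∘ G) (suc r))
      ≡⟨ cong (λ ps → hList (suc r) L +P sumP ps) (trans (cong (map (varP j *P_)) (LP.map-upTo G (suc r)))
                                                         (LP.map-applyUpTo G (varP j *P_) (suc r))) ⟨
    hList (suc r) L +P sumP (map (varP j *P_) (map G (L.upTo (suc r))))
      ≈⟨ +P-cong (≋-refl {hList (suc r) L}) (*P-sumP (varP j) (map G (L.upTo (suc r)))) ⟨
    hList (suc r) L +P varP j *P sumP (map G (L.upTo (suc r)))
      ≡⟨ cong (λ q → hList (suc r) L +P varP j *P q) (hList-∷ r j L) ⟨
    hList (suc r) L +P varP j *P hList r (j ∷ L)      ∎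
    where
    F G : ℕ → Poly n
    F a = (varP j ^P a) *P hList (suc r ∸ a) L
    G a = (varP j ^P a) *P hList (r ∸ a) L


  hList-del : (k : Fin n) (L : List (Fin n)) → k ∈ₗ L → Unique L → ∀ r →
              hList (suc r) L ≋ hList (suc r) (del k L) +P varP k *P hList r L
  hList-del k (k ∷ R) (here refl) (k∉R ∷ _) r = begin
    hList (suc r) (k ∷ R)                          ≈⟨ hList-suc-∷ r k R ⟩
    hList (suc r) R +P varP k *P hList r (k ∷ R)   ≡⟨ cong (λ D → hList (suc r) D +P varP k *P hList r (k ∷ R)) del-k∷R ⟨
    hList (suc r) (del k (k ∷ R)) +P varP k *P hList r (k ∷ R) ∎
    where
    del-k∷R : del k (k ∷ R) ≡ R
    del-k∷R = trans (LP.filter-reject (λ j → ¬? (j F.≟ k)) (λ k≢k → k≢k refl))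
                    (LP.filter-all (λ j → ¬? (j F.≟ k)) (All.map (_∘ sym) k∉R))
  hList-del k (p ∷ R) (there k∈R) (p∉R ∷ uR) r
    rewrite LP.filter-accept (λ j → ¬? (j F.≟ k)) {xs = R} (All.lookup p∉R k∈R) = go r
    where
    D = del k R
    IH : ∀ r → hList (suc r) R ≋ hList (suc r) D +P varP k *P hList r R
    IH = hList-del k R k∈R uR
    go : ∀ r → hList (suc r) (p ∷ R) ≋ hList (suc r) (p ∷ D) +P varP k *P hList r (p ∷ R)
    go zero = begin
      hList 1 (p ∷ R)                                        ≈⟨ hList-suc-∷ 0 p R ⟩
      hList 1 R +P varP p *P hList 0 (p ∷ R)                 ≈⟨ +P-cong (IH 0) (*P-congˡ (varP p) (hList-zero (p ∷ R))) ⟩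
      hList 1 D +P varP k *P hList 0 R +P varP p *P 1P       ≈⟨ +P-cong (+P-cong (≋-refl {hList 1 D}) (*P-congˡ (varP k) (hList-zero R))) ≋-refl ⟩
      hList 1 D +P varP k *P 1P +P varP p *P 1P
        ≈⟨ solve 3 (λ A xk xp → A :+ xk :* con 1ℚ :+ xp :* con 1ℚ := A :+ xp :* con 1ℚ :+ xk :* con 1ℚ) ≋-refl (hList 1 D) (varP k) (varP p) ⟩
      hList 1 D +P varP p *P 1P +P varP k *P 1P
        ≈⟨ +P-cong (+P-cong (≋-refl {hList 1 D}) (*P-congˡ (varP p) (hList-zero (p ∷ D)))) (*P-congˡ (varP k) (hList-zero (p ∷ R))) ⟨
      hList 1 D +P varP p *P hList 0 (p ∷ D) +P varP k *P hList 0 (p ∷ R)  ≈⟨ +P-cong (hList-suc-∷ 0 p D) ≋-refl ⟨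
      hList 1 (p ∷ D) +P varP k *P hList 0 (p ∷ R)           ∎
    go (suc r) = begin
      hList (2 ℕ.+ r) (p ∷ R)                                        ≈⟨ hList-suc-∷ (suc r) p R ⟩
      hList (2 ℕ.+ r) R +P varP p *P hList (suc r) (p ∷ R)           ≈⟨ +P-cong (IH (suc r)) (*P-congˡ (varP p) (go r)) ⟩
      hList (2 ℕ.+ r) D +P varP k *P hList (suc r) R +P varP p *P (hList (suc r) (p ∷ D) +P varP k *P hList r (p ∷ R))
        ≈⟨ solve 6 (λ A B C E xp xk → A :+ xk :* B :+ xp :* (C :+ xk :* E) := A :+ xp :* C :+ xk :* (B :+ xp :* E)) ≋-refl
             (hList (2 ℕ.+ r) D) (hList (suc r) R) (hList (suc r) (p ∷ D)) (hList r (p ∷ R)) (varP p) (varP k) ⟩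
      hList (2 ℕ.+ r) D +P varP p *P hList (suc r) (p ∷ D) +P varP k *P (hList (suc r) R +P varP p *P hList r (p ∷ R))
        ≈⟨ +P-cong (hList-suc-∷ (suc r) p D) (*P-congˡ (varP k) (hList-suc-∷ r p R)) ⟨
      hList (2 ℕ.+ r) (p ∷ D) +P varP k *P hList (suc r) (p ∷ R)     ∎

elements-unique : ∀ {n} (U : Subset n) → Unique (elements U)
elements-unique U = UniqueP.filter⁺ (_∈? U) (UniqueP.allFin⁺ _)

∈-elements : ∀ {n} {x : Fin n} (U : Subset n) → x ∈ U → x ∈ₗ elements U
∈-elements U x∈U = MembershipP.∈-filter⁺ (_∈? U) (MembershipP.∈-allFin _) x∈U

filter-filter : ∀ {A : Set} {P Q : A → Set} (P? : Decidable P) (Q? : Decidable Q) xs →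
  L.filter P? (L.filter Q? xs) ≡ L.filter (λ x → Q? x ×-dec P? x) xs
filter-filter P? Q? []       = refl
filter-filter P? Q? (x ∷ xs) with does (Q? x)
... | false = filter-filter P? Q? xs
... | true with does (P? x)
...   | true  = cong (x ∷_) (filter-filter P? Q? xs)
...   | false = filter-filter P? Q? xs

x∈p─q⇒x∉q : ∀ {n} {x : Fin n} (p q : Subset n) → x ∈ p ─ q → x ∉ q
x∈p─q⇒x∉q (true V.∷ p) (false V.∷ q) here ()
x∈p─q⇒x∉q (s V.∷ p)    (t V.∷ q)     (there x∈p─q) (there x∈q) = x∈p─q⇒x∉q p q x∈p─q x∈q

x∈p-y⇒x≢y : ∀ {n} {x y : Fin n} {p : Subset n} → x ∈ p - y → ¬ (x ≡ y)
x∈p-y⇒x≢y {x = x} {p = p} x∈p-x refl = x∈p─q⇒x∉q p ⁅ x ⁆ x∈p-x (x∈⁅x⁆ x)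

∣p∣≡1+∣p-x∣ : ∀ {n} {x : Fin n} {p : Subset n} → x ∈ p → ∣ p ∣ ≡ suc ∣ p - x ∣
∣p∣≡1+∣p-x∣ {p = true V.∷ p}  here         = cong (suc ∘ ∣_∣) (sym (p─⊥≡p p))
∣p∣≡1+∣p-x∣ {p = true V.∷ p}  (there x∈p) = cong suc (∣p∣≡1+∣p-x∣ x∈p)
∣p∣≡1+∣p-x∣ {p = false V.∷ p} (there x∈p) = ∣p∣≡1+∣p-x∣ x∈p

elements-─ : ∀ {n} (U : Subset n) (i : Fin n) → del i (elements U) ≡ elements (U - i)
elements-─ U i = trans (filter-filter (λ j → ¬? (j F.≟ i)) (_∈? U) (L.allFin _))
                       (LP.filter-≐ _ (_∈? (U - i)) (∈-U-i , ∈-U∧≢i) (L.allFin _))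
  where
  ∈-U-i : ∀ {x} → x ∈ U × ¬ (x ≡ i) → x ∈ U - i
  ∈-U-i (x∈U , x≢i) = x∈p∧x≢y⇒x∈p-y x∈U x≢i
  ∈-U∧≢i : ∀ {x} → x ∈ U - i → x ∈ U × ¬ (x ≡ i)
  ∈-U∧≢i x∈U-i = p─q⊆p U ⁅ i ⁆ x∈U-i , x∈p-y⇒x≢y x∈U-i

module _ {n : ℕ} where
  open PolyRingLaws {n}
  open PolySolver n
  open import Relation.Binary.Reasoning.Setoid (CommutativeRing.setoid (Poly-commutativeRing n))

  ∂-h-suc : (k : Fin n) (U : Subset n) → k ∈ U → ∀ r → ∂ k (h (suc r) U) ≋ h r U +P varP k *P ∂ k (h r U)
  ∂-h-suc k U k∈U r = begin
    ∂ k (hList (suc r) L)                                        ≈⟨ ∂-cong k (hList-del k L (∈-elements U k∈U) (elements-unique U) r) ⟩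
    ∂ k (hList (suc r) (del k L) +P varP k *P hList r L)         ≡⟨ ∂-+P k (hList (suc r) (del k L)) (varP k *P hList r L) ⟩
    ∂ k (hList (suc r) (del k L)) +P ∂ k (varP k *P hList r L)   ≡⟨ cong (_+P ∂ k (varP k *P hList r L))
                                                                        (∂-FreeOf k _ (FreeOf-hList k (suc r) (del k L) (AllP.all-filter (λ j → ¬? (j F.≟ k)) L))) ⟩
    ∂ k (varP k *P hList r L)                                    ≈⟨ ∂-varP-*P k (hList r L) ⟩
    hList r L +P varP k *P ∂ k (hList r L)                       ∎
    where
    L = elements U

  ∂-h-suc-─ : (i k : Fin n) (U : Subset n) → i ∈ U → ¬ (i ≡ k) → ∀ r →
              ∂ k (h (suc r) U) ≋ ∂ k (h (suc r) (U - i)) +P varP i *P ∂ k (h r U)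
  ∂-h-suc-─ i k U i∈U i≢k r = begin
    ∂ k (hList (suc r) L)                                        ≈⟨ ∂-cong k (hList-del i L (∈-elements U i∈U) (elements-unique U) r) ⟩
    ∂ k (hList (suc r) (del i L) +P varP i *P hList r L)         ≡⟨ ∂-+P k (hList (suc r) (del i L)) (varP i *P hList r L) ⟩
    ∂ k (hList (suc r) (del i L)) +P ∂ k (varP i *P hList r L)   ≡⟨ cong₂ (λ D q → ∂ k (hList (suc r) D) +P q) (elements-─ U i) (∂-varP-*P-≢ i≢k (hList r L)) ⟩
    ∂ k (h (suc r) (U - i)) +P varP i *P ∂ k (h r U)             ∎
    where L = elements U

  ∂-h-suc-removed : (i k : Fin n) (U : Subset n) → i ∈ U → k ∈ U → ¬ (i ≡ k) → ∀ r →
                    ∂ k (h (suc r) (U - i)) +P varP i *P ∂ k (h r U) ≋ h r U +P varP k *P ∂ k (h r U)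
  ∂-h-suc-removed i k U i∈U k∈U i≢k r = ≋-trans (≋-sym (∂-h-suc-─ i k U i∈U i≢k r)) (∂-h-suc k U k∈U r)

  ∂-h-exchange : (i k s : Fin n) (U : Subset n) → i ∈ U → k ∈ U → s ∈ U → ¬ (i ≡ k) → ¬ (i ≡ s) → ∀ r →
    ∂ k (h (suc r) (U - i)) ≋
    ∂ s (h (suc r) (U - i)) +P ((varP k +P -P varP i) *P ∂ k (h r U) +P (varP i +P -P varP s) *P ∂ s (h r U))
  ∂-h-exchange i k s U i∈U k∈U s∈U i≢k i≢s r = begin
    Gk                                        ≈⟨ solve 3 (λ G X F → G := G :+ X :* F :- X :* F) ≋-refl Gk xi Fk ⟩
    Gk +P xi *P Fk +P -P (xi *P Fk)           ≈⟨ +P-cong (∂-h-suc-removed i k U i∈U k∈U i≢k r) ≋-refl ⟩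
    H +P xk *P Fk +P -P (xi *P Fk)
      ≈⟨ solve 6 (λ H Xk Xi Xs A B → H :+ Xk :* A :- Xi :* A := H :+ Xs :* B :+ (Xk :* A :- Xi :* A :- Xs :* B)) ≋-refl H xk xi xs Fk Fs ⟩
    H +P xs *P Fs +P rest                     ≈⟨ +P-cong (∂-h-suc-removed i s U i∈U s∈U i≢s r) (≋-refl {rest}) ⟨
    Gs +P xi *P Fs +P rest
      ≈⟨ solve 6 (λ G Xk Xi Xs A B → G :+ Xi :* B :+ (Xk :* A :- Xi :* A :- Xs :* B) := G :+ ((Xk :- Xi) :* A :+ (Xi :- Xs) :* B))
                 ≋-refl Gs xk xi xs Fk Fs ⟩
    Gs +P ((xk +P -P xi) *P Fk +P (xi +P -P xs) *P Fs) ∎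
    where
    T = U - i
    Gk = ∂ k (h (suc r) T)
    Gs = ∂ s (h (suc r) T)
    Fk = ∂ k (h r U)
    Fs = ∂ s (h r U)
    H = h r U
    xi = varP i
    xk = varP k
    xs = varP s
    rest = varP k *P Fk +P -P (varP i *P Fk) +P -P (varP s *P Fs)

-- Ideals

module _ {n m : ℕ} (g : Fin m → Poly n) where
  open PolyRingLaws {n}
  open PolySolver n

  combination : (Fin m → Poly n) → List (Fin m) → Poly n
  combination q xs = sumP (map (λ i → q i *P g i) xs)

  InIdeal-resp-≋ : {a b : Poly n} → a ≋ b → InIdeal g a → InIdeal g b
  InIdeal-resp-≋ ⟨ a≈b ⟩ (q , a≈qg) = q , (λ e → trans (sym (a≈b e)) (a≈qg e))

  InIdeal-+P : {a b : Poly n} → InIdeal g a → InIdeal g b → InIdeal g (a +P b)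
  InIdeal-+P {a} {b} (q₁ , a≈) (q₂ , b≈) =
    (λ i → q₁ i +P q₂ i) ,
    coeff-≡ (≋-trans (+P-cong {a} {combination q₁ (L.allFin m)} {b} {combination q₂ (L.allFin m)} ⟨ a≈ ⟩ ⟨ b≈ ⟩)
                     (combination-+ (L.allFin m)))
    where
    combination-+ : ∀ xs → combination q₁ xs +P combination q₂ xs ≋ combination (λ i → q₁ i +P q₂ i) xs
    combination-+ []       = ≋-refl
    combination-+ (x ∷ xs) = ≋-trans
      (solve 5 (λ A B C D G → A :* G :+ C :+ (B :* G :+ D) := (A :+ B) :* G :+ (C :+ D)) ≋-refl
             (q₁ x) (q₂ x) (combination q₁ xs) (combination q₂ xs) (g x))
      (+P-cong ≋-refl (combination-+ xs))

  InIdeal-*P : (c : Poly n) {a : Poly n} → InIdeal g a → InIdeal g (c *P a)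
  InIdeal-*P c {a} (q , a≈) =
    (λ i → c *P q i) , coeff-≡ (≋-trans (*P-congˡ c {a} {combination q (L.allFin m)} ⟨ a≈ ⟩) (combination-* (L.allFin m)))
    where
    combination-* : ∀ xs → c *P combination q xs ≋ combination (λ i → c *P q i) xs
    combination-* []       = ≋-reflexive (*P-zeroʳ c)
    combination-* (x ∷ xs) = ≋-trans
      (solve 4 (λ C A B G → C :* (A :* G :+ B) := C :* A :* G :+ C :* B) ≋-refl c (q x) (combination q xs) (g x))
      (+P-cong ≋-refl (combination-* xs))

  InIdeal-generator : (i : Fin m) → InIdeal g (g i)
  InIdeal-generator i = δᵢ , coeff-≡ (≋-sym (combination-δᵢ (L.allFin m) (MembershipP.∈-allFin i) (UniqueP.allFin⁺ m)))
    where
    δᵢ : Fin m → Poly n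
    δᵢ j = if does (j F.≟ i) then 1P else 0P
    combination-δᵢ-∉ : ∀ xs → All (λ j → ¬ (j ≡ i)) xs → combination δᵢ xs ≋ 0P
    combination-δᵢ-∉ []       []          = ≋-refl
    combination-δᵢ-∉ (x ∷ xs) (x≢i ∷ xs≢i) with x F.≟ i
    ... | yes x≡i = ⊥-elim (x≢i x≡i)
    ... | no _    = combination-δᵢ-∉ xs xs≢i
    combination-δᵢ : ∀ xs → i ∈ₗ xs → Unique xs → combination δᵢ xs ≋ g i
    combination-δᵢ (x ∷ xs) (here refl) (x∉xs ∷ _) with x F.≟ x
    ... | yes _ = ≋-trans (+P-cong (*P-identityˡ (g x)) (combination-δᵢ-∉ xs (All.map (_∘ sym) x∉xs))) (+P-identityʳ (g x))
    ... | no x≢x = ⊥-elim (x≢x refl)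
    combination-δᵢ (x ∷ xs) (there i∈xs) (x∉xs ∷ uxs) with x F.≟ i
    ... | yes refl = ⊥-elim (All.lookup x∉xs i∈xs refl)
    ... | no _     = combination-δᵢ xs i∈xs uxs

-- The index s = max (J ∩ [0, i])

last-∷ʳ : ∀ {A : Set} (xs : List A) x → L.last (xs ++ x ∷ []) ≡ just x
last-∷ʳ []           x = refl
last-∷ʳ (y ∷ [])     x = refl
last-∷ʳ (y ∷ z ∷ xs) x = last-∷ʳ (z ∷ xs) x

last-∈ : ∀ {A : Set} (xs : List A) {s} → L.last xs ≡ just s → s ∈ₗ xs
last-∈ (x ∷ [])     refl = here refl
last-∈ (x ∷ y ∷ xs) eq   = there (last-∈ (y ∷ xs) eq)

last-nothing : ∀ {A : Set} (xs : List A) → L.last xs ≡ nothing → xs ≡ []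
last-nothing []           _ = refl
last-nothing (x ∷ [])     ()
last-nothing (x ∷ y ∷ xs) eq with () ← last-nothing (y ∷ xs) eq

filterᵇ-cong : ∀ {A : Set} {P Q : A → Bool} → (∀ x → P x ≡ Q x) → ∀ xs → L.filterᵇ P xs ≡ L.filterᵇ Q xs
filterᵇ-cong P≡Q []       = refl
filterᵇ-cong {P = P} {Q} P≡Q (x ∷ xs) with P x | Q x | P≡Q x
... | true  | .true  | refl = cong (x ∷_) (filterᵇ-cong P≡Q xs)
... | false | .false | refl = filterᵇ-cong P≡Q xs

filterᵇ-map : ∀ {A B : Set} (P : B → Bool) (f : A → B) xs → L.filterᵇ P (map f xs) ≡ map f (L.filterᵇ (P ∘ f) xs)
filterᵇ-map P f []       = refl
filterᵇ-map P f (x ∷ xs) with P (f x)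
... | true  = cong (f x ∷_) (filterᵇ-map P f xs)
... | false = filterᵇ-map P f xs

<ᵇ-suc : ∀ m n → (m ℕ.<ᵇ suc n) ≡ (m ℕ.≤ᵇ n)
<ᵇ-suc zero    n = refl
<ᵇ-suc (suc m) n = refl

allFin≤ : ∀ {n} → Fin n → List (Fin n)
allFin≤ i = L.filterᵇ (λ k → toℕ k ℕ.≤ᵇ toℕ i) (L.allFin _)

allFin≤-∷ʳ : ∀ {n} (i : Fin n) → ∃ λ ys → allFin≤ i ≡ ys ++ i ∷ []
allFin≤-∷ʳ {suc n} F.zero    = [] , cong (F.zero ∷_) (LP.filter-none (λ k → T? (toℕ k ℕ.≤ᵇ 0)) (AllP.tabulate⁺ {f = F.suc} (λ _ ())))
allFin≤-∷ʳ {suc n} (F.suc i) with ys , eq ← allFin≤-∷ʳ i = F.zero ∷ map F.suc ys , cong (F.zero ∷_) (begin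
  L.filterᵇ P (L.tabulate F.suc)                   ≡⟨ cong (L.filterᵇ P) (LP.map-tabulate (λ k → k) F.suc) ⟨
  L.filterᵇ P (map F.suc (L.allFin n))             ≡⟨ filterᵇ-map P F.suc (L.allFin n) ⟩
  map F.suc (L.filterᵇ (P ∘ F.suc) (L.allFin n))   ≡⟨ cong (map F.suc) (filterᵇ-cong (λ k → <ᵇ-suc (toℕ k) (toℕ i)) (L.allFin n)) ⟩
  map F.suc (allFin≤ i)                           ≡⟨ cong (map F.suc) eq ⟩
  map F.suc (ys ++ i ∷ [])                         ≡⟨ LP.map-++ F.suc ys (i ∷ []) ⟩
  map F.suc ys ++ F.suc i ∷ []                     ∎)
  where
  open ≡-Reasoning
  P : Fin (suc n) → Bool
  P k = toℕ k ℕ.≤ᵇ toℕ (F.suc i)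

maxUpTo-just : ∀ {n} (J : Subset n) (i s : Fin n) → maxUpTo J i ≡ just s → s ∈ J × toℕ s ℕ.≤ toℕ i
maxUpTo-just J i s eq with s∈upTo , s∈J ← MembershipP.∈-filter⁻ (_∈? J) (last-∈ _ eq) =
  s∈J , ℕP.≤ᵇ⇒≤ (toℕ s) (toℕ i) (proj₂ (MembershipP.∈-filter⁻ (T? ∘ _) {xs = L.allFin _} s∈upTo))

maxUpTo-nothing : ∀ {n} (J : Subset n) (i k : Fin n) → maxUpTo J i ≡ nothing → k ∈ J → ¬ (toℕ k ℕ.≤ toℕ i)
maxUpTo-nothing J i k eq k∈J k≤i with last-nothing _ eq
... | empty = case subst (k ∈ₗ_) empty k∈filter of λ ()
  where
  k∈filter : k ∈ₗ L.filter (_∈? J) (allFin≤ i)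
  k∈filter = MembershipP.∈-filter⁺ (_∈? J) (MembershipP.∈-filter⁺ (T? ∘ _) (MembershipP.∈-allFin k) (ℕP.≤⇒≤ᵇ k≤i)) k∈J

maxUpTo-∈ : ∀ {n} (J : Subset n) (i : Fin n) → i ∈ J → maxUpTo J i ≡ just i
maxUpTo-∈ J i i∈J with ys , eq ← allFin≤-∷ʳ i = begin
  L.last (L.filter (_∈? J) (allFin≤ i))                     ≡⟨ cong (L.last ∘ L.filter (_∈? J)) eq ⟩
  L.last (L.filter (_∈? J) (ys ++ i ∷ []))                   ≡⟨ cong L.last (LP.filter-++ (_∈? J) ys (i ∷ [])) ⟩
  L.last (L.filter (_∈? J) ys ++ L.filter (_∈? J) (i ∷ []))  ≡⟨ cong (λ zs → L.last (L.filter (_∈? J) ys ++ zs)) (LP.filter-accept (_∈? J) i∈J) ⟩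
  L.last (L.filter (_∈? J) ys ++ i ∷ [])                     ≡⟨ last-∷ʳ (L.filter (_∈? J) ys) i ⟩
  just i                                                     ∎
  where open ≡-Reasoning

-- The induction

suffix : ∀ {n} → ℕ → Subset n
suffix c = V.tabulate (λ k → c ℕ.≤ᵇ toℕ k)

suffix⁺ : ∀ {n} {c} {x : Fin n} → c ℕ.≤ toℕ x → x ∈ suffix c
suffix⁺ {c = c} {x} c≤x = VP.lookup⇒[]= x _ (trans (VP.lookup∘tabulate _ x) (Equivalence.to BoolP.T-≡ (ℕP.≤⇒≤ᵇ c≤x)))

suffix⁻ : ∀ {n} {c} {x : Fin n} → x ∈ suffix c → c ℕ.≤ toℕ x
suffix⁻ {c = c} {x} x∈ =
  ℕP.≤ᵇ⇒≤ c (toℕ x) (Equivalence.from BoolP.T-≡ (trans (sym (VP.lookup∘tabulate _ x)) (VP.[]=⇒lookup x∈)))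

∸-suc : ∀ {n t} → suc t ℕ.≤ n → n ∸ t ≡ suc (n ∸ suc t)
∸-suc le = ℕP.+-∸-assoc 1 le

module Induction {n : ℕ} (J : Subset n) where

  -- U (suc (toℕ i)) is definitionally the set J ∪ above i occurring in p J i.
  U : ℕ → Subset n
  U c = J ∪ suffix c

  degree : ℕ → ℕ
  degree c = n ∸ ∣ U c ∣ ℕ.+ 1

  ∈U⁺ : ∀ {c x} → x ∈ J ⊎ c ℕ.≤ toℕ x → x ∈ U c
  ∈U⁺ (inj₁ x∈J) = x∈p∪q⁺ (inj₁ x∈J)
  ∈U⁺ (inj₂ c≤x) = x∈p∪q⁺ (inj₂ (suffix⁺ c≤x))

  ∈U⁻ : ∀ {c x} → x ∈ U c → x ∈ J ⊎ c ℕ.≤ toℕ x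
  ∈U⁻ {c} x∈U = Sum.map₂ suffix⁻ (x∈p∪q⁻ J (suffix c) x∈U)

  U-∈ : ∀ {i} → i ∈ J → U (toℕ i) ≡ U (suc (toℕ i))
  U-∈ {i} i∈J = ⊆-antisym (∈U⁺ ∘ widen ∘ ∈U⁻) (∈U⁺ ∘ Sum.map₂ ℕP.<⇒≤ ∘ ∈U⁻)
    where
    widen : ∀ {x} → x ∈ J ⊎ toℕ i ℕ.≤ toℕ x → x ∈ J ⊎ toℕ i ℕ.< toℕ x
    widen (inj₁ x∈J) = inj₁ x∈J
    widen {x} (inj₂ i≤x) with ℕP.m≤n⇒m<n∨m≡n i≤x
    ... | inj₁ i<x = inj₂ i<x
    ... | inj₂ i≡x = inj₁ (subst (_∈ J) (FP.toℕ-injective i≡x) i∈J)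

  U-∉ : ∀ {i} → i ∉ J → U (suc (toℕ i)) ≡ U (toℕ i) - i
  U-∉ {i} i∉J = ⊆-antisym
    (λ x∈U → x∈p∧x≢y⇒x∈p-y (∈U⁺ (Sum.map₂ ℕP.<⇒≤ (∈U⁻ x∈U))) (≢i (∈U⁻ x∈U)))
    (λ x∈U-i → ∈U⁺ (narrow (x∈p-y⇒x≢y x∈U-i) (∈U⁻ (p─q⊆p (U (toℕ i)) ⁅ i ⁆ x∈U-i))))
    where
    ≢i : ∀ {x} → x ∈ J ⊎ toℕ i ℕ.< toℕ x → ¬ (x ≡ i)
    ≢i (inj₁ x∈J) refl = i∉J x∈J
    ≢i (inj₂ i<x) refl = ℕP.<-irrefl refl i<x
    narrow : ∀ {x} → ¬ (x ≡ i) → x ∈ J ⊎ toℕ i ℕ.≤ toℕ x → x ∈ J ⊎ toℕ i ℕ.< toℕ x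
    narrow x≢i = Sum.map₂ (λ i≤x → ℕP.≤∧≢⇒< i≤x (x≢i ∘ sym ∘ FP.toℕ-injective))

  U-n : U n ≡ J
  U-n = ⊆-antisym (∈J ∘ ∈U⁻ {n}) (∈U⁺ {n} ∘ inj₁)
    where
    ∈J : ∀ {x} → x ∈ J ⊎ n ℕ.≤ toℕ x → x ∈ J
    ∈J     (inj₁ x∈J) = x∈J
    ∈J {x} (inj₂ n≤x) = ⊥-elim (ℕP.<⇒≱ (FP.toℕ<n x) n≤x)

  degree-∉ : ∀ {i} → i ∉ J → degree (suc (toℕ i)) ≡ suc (degree (toℕ i))
  degree-∉ {i} i∉J = trans (cong (ℕ._+ 1) (∸-suc (subst (ℕ._≤ n) card (∣p∣≤n (U (toℕ i))))))
                           (cong (λ u → suc (n ∸ u ℕ.+ 1)) (sym card))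
    where
    card : ∣ U (toℕ i) ∣ ≡ suc ∣ U (suc (toℕ i)) ∣
    card = trans (∣p∣≡1+∣p-x∣ (∈U⁺ (inj₂ ℕP.≤-refl))) (cong (suc ∘ ∣_∣) (sym (U-∉ i∉J)))

  Claim : ℕ → Set
  Claim c = ∀ k → k ∈ J → toℕ k ℕ.< c → InIdeal (p J) (∂ k (h (degree c) (U c)))

  p-maxUpTo-just : ∀ {i s} → maxUpTo J i ≡ just s → p J i ≡ ∂ s (h (degree (suc (toℕ i))) (U (suc (toℕ i))))
  p-maxUpTo-just eq rewrite eq = refl

  step-∈ : ∀ {i} → i ∈ J → Claim (toℕ i) → Claim (suc (toℕ i))
  step-∈ {i} i∈J IH k k∈J k<1+i with ℕP.m≤n⇒m<n∨m≡n (ℕ.s≤s⁻¹ k<1+i)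
  ... | inj₁ k<i = subst (λ S → InIdeal (p J) (∂ k (h (n ∸ ∣ S ∣ ℕ.+ 1) S))) (U-∈ i∈J) (IH k k∈J k<i)
  ... | inj₂ k≡i with refl ← FP.toℕ-injective k≡i =
    subst (InIdeal (p J)) (p-maxUpTo-just (maxUpTo-∈ J i i∈J)) (InIdeal-generator (p J) i)

  step-∉ : ∀ {i} → i ∉ J → Claim (toℕ i) → Claim (suc (toℕ i))
  step-∉ {i} i∉J IH k k∈J k<1+i with maxUpTo J i in max≡
  ... | nothing = ⊥-elim (maxUpTo-nothing J i k max≡ k∈J (ℕ.s≤s⁻¹ k<1+i))
  ... | just s  = subst₂ (λ d S → InIdeal (p J) (∂ k (h d S))) (sym (degree-∉ i∉J)) (sym (U-∉ i∉J))
    (InIdeal-resp-≋ (p J) (PolyRingLaws.≋-sym exchange) (InIdeal-+P (p J) {∂ s (h (suc r) (U (toℕ i) - i))} generatorᵢ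
      (InIdeal-+P (p J) {c₁ *P Fk} (InIdeal-*P (p J) c₁ {Fk} (IH k k∈J k<i)) (InIdeal-*P (p J) c₂ {Fs} (IH s s∈J s<i)))))
    where
    r = degree (toℕ i)
    s∈J = proj₁ (maxUpTo-just J i s max≡)
    i∈U = ∈U⁺ (inj₂ ℕP.≤-refl)
    i≢k : ¬ (i ≡ k)
    i≢k refl = i∉J k∈J
    i≢s : ¬ (i ≡ s)
    i≢s refl = i∉J s∈J
    k<i : toℕ k ℕ.< toℕ i
    k<i = ℕP.≤∧≢⇒< (ℕ.s≤s⁻¹ k<1+i) (i≢k ∘ sym ∘ FP.toℕ-injective)
    s<i : toℕ s ℕ.< toℕ i
    s<i = ℕP.≤∧≢⇒< (proj₂ (maxUpTo-just J i s max≡)) (i≢s ∘ sym ∘ FP.toℕ-injective)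
    Fk = ∂ k (h r (U (toℕ i)))
    Fs = ∂ s (h r (U (toℕ i)))
    c₁ = varP k +P -P varP i
    c₂ = varP i +P -P varP s
    exchange = ∂-h-exchange i k s (U (toℕ i)) i∈U (∈U⁺ {toℕ i} (inj₁ k∈J)) (∈U⁺ {toℕ i} (inj₁ s∈J)) i≢k i≢s r
    generatorᵢ : InIdeal (p J) (∂ s (h (suc r) (U (toℕ i) - i)))
    generatorᵢ = subst₂ (λ d S → InIdeal (p J) (∂ s (h d S))) (degree-∉ i∉J) (U-∉ i∉J)
                        (subst (InIdeal (p J)) (p-maxUpTo-just max≡) (InIdeal-generator (p J) i))

  claim : ∀ c → c ℕ.≤ n → Claim c
  claim zero    _   k _ ()
  claim (suc c) c<n = subst (Claim ∘ suc) (FP.toℕ-fromℕ< c<n) (step (subst Claim (sym (FP.toℕ-fromℕ< c<n)) (claim c (ℕP.<⇒≤ c<n))))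
    where
    i = F.fromℕ< c<n
    step : Claim (toℕ i) → Claim (suc (toℕ i))
    step with i ∈? J
    ... | yes i∈J = step-∈ i∈J
    ... | no i∉J  = step-∉ i∉J

lemma3p4 : (n : ℕ) (J : Subset n) (j : Fin n) → j ∈ J →
    InIdeal (p J) (∂ j (h (n ∸ ∣ J ∣ + 1) J))
lemma3p4 n J j j∈J = subst (λ S → InIdeal (p J) (∂ j (h (n ∸ ∣ S ∣ + 1) S))) U-n (claim n ℕP.≤-refl j j∈J (FP.toℕ<n j))
  where open Induction J
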